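{- For every integer $b\ge 3$, there exists a graph $G$ such that $rvc(G)=3$ and $srvc(G)=b$.
   Context: All graphs are finite, simple and connected. A vertex-coloured path is vertex-rainbow if its internal vertices have distinct colours. $rvc(G)$ is the minimum number of colours in a vertex-colouring in which any two vertices are joined by a vertex-rainbow path; $srvc(G)$ is the minimum number of colours in a vertex-colouring in which any two vertices $u,v$ are joined by a vertex-rainbow $u$–$v$ geodesic (a $u$–$v$ path of length $d(u,v)$). -}

module Defs where

open import Data.Nat using (ℕ; _≤_; _<_; suc)
open import Data.Fin using (Fin)
open import Data.List using (List; []; _∷_; _++_; [_]; length)
open import Data.List.Relation.Unary.Linked using (Linked)
open import Data.List.Relation.Unary.AllPairs using (AllPairs)
open import Data.List.Relation.Unary.Unique.Propositional using (Unique)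
open import Data.Product using (Σ; _×_; ∃)
open import Relation.Binary.PropositionalEquality using (_≡_; _≢_)
open import Relation.Nullary using (¬_)

record Graph : Set₁ where
  field
    n      : ℕ
    Adj    : Fin n → Fin n → Set
    irrefl : ∀ {x} → ¬ Adj x x
    sym    : ∀ {x y} → Adj x y → Adj y x

module _ (G : Graph) where
  open Graph G

  -- A u–v path for u ≠ v, given by its list of internal vertices:
  -- the vertex sequence u ∷ is ++ [ v ] has consecutive vertices adjacent
  -- and all vertices distinct.
  IsPath : Fin n → Fin n → List (Fin n) → Set
  IsPath u v is = Linked Adj (u ∷ is ++ [ v ]) × Unique (u ∷ is ++ [ v ])

  pathLength : List (Fin n) → ℕ
  pathLength is = suc (length is)

  Connected : Set
  Connected = ∀ u v → u ≢ v → ∃ λ is → IsPath u v is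

  IsGeodesic : Fin n → Fin n → List (Fin n) → Set
  IsGeodesic u v is = IsPath u v is × (∀ js → IsPath u v js → pathLength is ≤ pathLength js)

  VertexRainbow : {k : ℕ} → (Fin n → Fin k) → List (Fin n) → Set
  VertexRainbow c is = AllPairs (λ x y → c x ≢ c y) is

  RVConnecting : {k : ℕ} → (Fin n → Fin k) → Set
  RVConnecting c = ∀ u v → u ≢ v → ∃ λ is → IsPath u v is × VertexRainbow c is

  SRVConnecting : {k : ℕ} → (Fin n → Fin k) → Set
  SRVConnecting c = ∀ u v → u ≢ v → ∃ λ is → IsGeodesic u v is × VertexRainbow c is

  rvc≡ : ℕ → Set
  rvc≡ k = (∃ λ (c : Fin n → Fin k) → RVConnecting c)
         × (∀ m → m < k → (c : Fin n → Fin m) → ¬ RVConnecting c)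

  srvc≡ : ℕ → Set
  srvc≡ k = (∃ λ (c : Fin n → Fin k) → SRVConnecting c)
          × (∀ m → m < k → (c : Fin n → Fin m) → ¬ SRVConnecting c)

module Submission where

-- Fix b ≥ 3.  Take a clique X₀,…,X_{b-1}; give every Xᵢ two private
-- neighbours Pᵢ and Qᵢ; join all Pᵢ to a hub H₁, all Qᵢ to a hub H₃, and join the
-- hubs by a path H₁ – H₂ – H₃.  The graph has diameter 3, and for i ≠ j the
-- only Pᵢ–Qⱼ path with at most two internal vertices is Pᵢ Xᵢ Xⱼ Qⱼ.
--
--  * srvc = b: colouring Xᵢ with colour i (and the rest with colours 0,1) makes a
--    rainbow geodesic available between every pair.  Conversely, with fewer than b
--    colours two clique vertices Xᵢ, Xⱼ share a colour (pigeonhole), and the unique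
--    Pᵢ–Qⱼ geodesic Pᵢ Xᵢ Xⱼ Qⱼ is then not rainbow.
--  * rvc = 3: the detour Pᵢ H₁ H₂ H₃ Qⱼ repairs the problem with 3 colours;
--    with at most 2 colours a rainbow path has at most 2 internal vertices, so
--    the same pigeonhole argument applies.

open import Defs
open import Data.Nat using (ℕ; _≤_; _<_; suc; _+_; z≤n; s≤s)
open import Data.Nat.Properties using (≤-trans; ≤-pred)
open import Data.Product using (Σ; _×_; _,_; proj₁; ∃; ∃₂)
open import Data.Sum using (_⊎_; inj₁; inj₂) renaming ([_,_] to either)
open import Data.Fin using (Fin; zero; suc; splitAt; _↑ˡ_; _↑ʳ_)
open import Data.Fin.Properties
  using (splitAt-↑ˡ; splitAt-↑ʳ; splitAt⁻¹-↑ˡ; splitAt⁻¹-↑ʳ; pigeonhole; <⇒≢; injective⇒≤)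
  renaming (_≟_ to _≟F_)
open import Data.List using (List; []; _∷_; _++_; [_]; length; map; lookup)
open import Data.List.Properties using (map-++; length-map)
open import Data.List.Membership.Propositional.Properties using (∈-lookup)
open import Data.List.Relation.Unary.All as All using ([]; _∷_)
open import Data.List.Relation.Unary.Linked using (Linked; [-]; _∷_)
import Data.List.Relation.Unary.Linked as Linked
import Data.List.Relation.Unary.Linked.Properties as Linked
open import Data.List.Relation.Unary.AllPairs using (AllPairs; []; _∷_)
import Data.List.Relation.Unary.AllPairs as AllPairs
import Data.List.Relation.Unary.AllPairs.Properties as AllPairs
open import Data.List.Relation.Unary.Unique.Propositional using (Unique)
import Data.List.Relation.Unary.Unique.Propositional.Properties as Unique
open import Data.Unit using (⊤; tt)
open import Data.Empty using (⊥; ⊥-elim)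
open import Function using (_∘_)
open import Relation.Nullary using (¬_; yes; no)
open import Relation.Binary.PropositionalEquality
  using (_≡_; _≢_; refl; sym; trans; cong; subst; subst₂)

Rainbow : {V : Set} {m : ℕ} → (V → Fin m) → List V → Set
Rainbow c ks = AllPairs (λ x y → c x ≢ c y) ks

rainbow-lookup-injective : {V : Set} {m : ℕ} (c : V → Fin m) {ks : List V} → Rainbow c ks →
                           ∀ {i j} → c (lookup ks i) ≡ c (lookup ks j) → i ≡ j
rainbow-lookup-injective c (_ ∷ _)     {zero}  {zero}  _    = refl
rainbow-lookup-injective c (fresh ∷ _) {zero}  {suc j} same = ⊥-elim (All.lookup fresh (∈-lookup j) same)
rainbow-lookup-injective c (fresh ∷ _) {suc i} {zero}  same = ⊥-elim (All.lookup fresh (∈-lookup i) (sym same))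
rainbow-lookup-injective c (_ ∷ rest)  {suc i} {suc j} same = cong suc (rainbow-lookup-injective c rest same)

rainbow-length : {V : Set} {m : ℕ} (c : V → Fin m) {ks : List V} → Rainbow c ks → length ks ≤ m
rainbow-length c r = injective⇒≤ (rainbow-lookup-injective c r)

rainbow-map : {U W : Set} {m : ℕ} (f : U → W) (g : W → U) → (∀ x → g (f x) ≡ x) →
              (c : U → Fin m) {ks : List U} → Rainbow c ks → Rainbow (c ∘ g) (map f ks)
rainbow-map f g g∘f≡id c r = AllPairs.map⁺ {f = f} (AllPairs.map distinct r)
  where
  distinct : ∀ {x y} → c x ≢ c y → c (g (f x)) ≢ c (g (f y))
  distinct {x} {y} = subst₂ (λ x′ y′ → c x′ ≢ c y′) (sym (g∘f≡id x)) (sym (g∘f≡id y))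

module _ {V : Set} (A : V → V → Set) where

  Walk : V → V → List V → Set
  Walk a c ks = Linked A (a ∷ ks ++ [ c ])

  Path : V → V → List V → Set
  Path a c ks = Walk a c ks × Unique (a ∷ ks ++ [ c ])

  Geodesic : V → V → List V → Set
  Geodesic a c ks = Path a c ks × (∀ ls → Path a c ls → length ks ≤ length ls)

  RainbowPaths : {m : ℕ} → (V → Fin m) → Set
  RainbowPaths col = ∀ a c → a ≢ c → ∃ λ ks → Path a c ks × Rainbow col ks

  RainbowGeodesics : {m : ℕ} → (V → Fin m) → Set
  RainbowGeodesics col = ∀ a c → a ≢ c → ∃ λ ks → Geodesic a c ks × Rainbow col ks

module _ {V : Set} {A : V → V → Set} {a c : V} where

  nonadjacent⇒internal≥1 : ¬ A a c → ∀ ks → Walk A a c ks → 1 ≤ length ks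
  nonadjacent⇒internal≥1 a≁c []      (a~c ∷ _) = ⊥-elim (a≁c a~c)
  nonadjacent⇒internal≥1 _   (_ ∷ _) _         = s≤s z≤n

  distant⇒internal≥2 : ¬ A a c → (∀ w → A a w → A w c → ⊥) → ∀ ks → Walk A a c ks → 2 ≤ length ks
  distant⇒internal≥2 a≁c _      []              (a~c ∷ _)         = ⊥-elim (a≁c a~c)
  distant⇒internal≥2 _   no-mid (w ∷ [])        (a~w ∷ w~c ∷ _)   = ⊥-elim (no-mid w a~w w~c)
  distant⇒internal≥2 _   _      (_ ∷ _ ∷ _)     _                 = s≤s (s≤s z≤n)

path-map : {U W : Set} {R : U → U → Set} {S : W → W → Set} (f : U → W) →
           (∀ {x y} → R x y → S (f x) (f y)) → (∀ {x y} → f x ≡ f y → x ≡ y) →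
           ∀ {a c ks} → Path R a c ks → Path S (f a) (f c) (map f ks)
path-map {S = S} f preserves injective {a} {c} {ks} (walk , unique) =
    subst (Linked S) shape (Linked.map⁺ {f = f} (Linked.map preserves walk))
  , subst Unique shape (Unique.map⁺ injective unique)
  where
  shape : map f (a ∷ ks ++ [ c ]) ≡ f a ∷ map f ks ++ [ f c ]
  shape = cong (f a ∷_) (map-++ f ks [ c ])

module _ {V : Set} where

  distinct₂ : {x y : V} → x ≢ y → Unique (x ∷ y ∷ [])
  distinct₂ d = (d ∷ []) ∷ [] ∷ []

  distinct₃ : {x y z : V} → x ≢ y → x ≢ z → y ≢ z → Unique (x ∷ y ∷ z ∷ [])
  distinct₃ d₁ d₂ d₃ = (d₁ ∷ d₂ ∷ []) ∷ (d₃ ∷ []) ∷ [] ∷ []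

  distinct₄ : {x y z w : V} → x ≢ y → x ≢ z → x ≢ w → y ≢ z → y ≢ w → z ≢ w →
              Unique (x ∷ y ∷ z ∷ w ∷ [])
  distinct₄ d₁ d₂ d₃ d₄ d₅ d₆ = (d₁ ∷ d₂ ∷ d₃ ∷ []) ∷ (d₄ ∷ d₅ ∷ []) ∷ (d₆ ∷ []) ∷ [] ∷ []

  allPairs₂ : {R : V → V → Set} {x y : V} → R x y → AllPairs R (x ∷ y ∷ [])
  allPairs₂ r = (r ∷ []) ∷ [] ∷ []

rvConnecting⇒connected : (G : Graph) {m : ℕ} (c : Fin (Graph.n G) → Fin m) →
                         RVConnecting G c → Connected G
rvConnecting⇒connected G c rv u v u≢v with rv u v u≢v
... | is , path , _ = is , path

module Encoding {V : Set} (A : V → V → Set)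
                (A-irrefl : ∀ {v} → ¬ A v v) (A-sym : ∀ {u v} → A u v → A v u)
                (N : ℕ) (toV : Fin N → V) (fromV : V → Fin N)
                (toV-fromV : ∀ v → toV (fromV v) ≡ v) (fromV-toV : ∀ x → fromV (toV x) ≡ x) where

  graph : Graph
  graph = record { n = N ; Adj = λ x y → A (toV x) (toV y) ; irrefl = A-irrefl ; sym = A-sym }

  fromV-injective : ∀ {a c} → fromV a ≡ fromV c → a ≡ c
  fromV-injective {a} {c} e = trans (sym (toV-fromV a)) (trans (cong toV e) (toV-fromV c))

  toV-injective : ∀ {x y} → toV x ≡ toV y → x ≡ y
  toV-injective {x} {y} e = trans (sym (fromV-toV x)) (trans (cong fromV e) (fromV-toV y))

  encode : ∀ {a c ks} → Path A a c ks → IsPath graph (fromV a) (fromV c) (map fromV ks)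
  encode = path-map fromV (λ {a} {c} → subst₂ A (sym (toV-fromV a)) (sym (toV-fromV c))) fromV-injective

  decode : ∀ {x y js} → IsPath graph x y js → Path A (toV x) (toV y) (map toV js)
  decode = path-map toV (λ r → r) toV-injective

  encode′ : ∀ {x y ks} → Path A (toV x) (toV y) ks → IsPath graph x y (map fromV ks)
  encode′ {x} {y} p = subst₂ (λ x′ y′ → IsPath graph x′ y′ _) (fromV-toV x) (fromV-toV y) (encode p)

  decode′ : ∀ {a c js} → IsPath graph (fromV a) (fromV c) js → Path A a c (map toV js)
  decode′ {a} {c} p = subst₂ (λ a′ c′ → Path A a′ c′ _) (toV-fromV a) (toV-fromV c) (decode p)

  rvConnecting↑ : ∀ {m} (col : V → Fin m) → RainbowPaths A col → RVConnecting graph (col ∘ toV)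
  rvConnecting↑ col rv x y x≢y with rv (toV x) (toV y) (x≢y ∘ toV-injective)
  ... | ks , path , r = map fromV ks , encode′ path , rainbow-map fromV toV toV-fromV col r

  rvConnecting↓ : ∀ {m} (col : Fin N → Fin m) → RVConnecting graph col → RainbowPaths A (col ∘ fromV)
  rvConnecting↓ col rv a c a≢c with rv (fromV a) (fromV c) (a≢c ∘ fromV-injective)
  ... | js , path , r = map toV js , decode′ path , rainbow-map toV fromV fromV-toV col r

  srvConnecting↑ : ∀ {m} (col : V → Fin m) → RainbowGeodesics A col → SRVConnecting graph (col ∘ toV)
  srvConnecting↑ col srv x y x≢y with srv (toV x) (toV y) (x≢y ∘ toV-injective)
  ... | ks , (path , shortest) , r =
    map fromV ks , (encode′ path , λ js p → s≤s (shorter js p)) , rainbow-map fromV toV toV-fromV col r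
    where
    shorter : ∀ js → IsPath graph x y js → length (map fromV ks) ≤ length js
    shorter js p = subst₂ _≤_ (sym (length-map fromV ks)) (length-map toV js) (shortest (map toV js) (decode p))

  srvConnecting↓ : ∀ {m} (col : Fin N → Fin m) → SRVConnecting graph col → RainbowGeodesics A (col ∘ fromV)
  srvConnecting↓ col srv a c a≢c with srv (fromV a) (fromV c) (a≢c ∘ fromV-injective)
  ... | js , (path , shortest) , r =
    map toV js , (decode′ path , shorter) , rainbow-map toV fromV fromV-toV col r
    where
    shorter : ∀ ls → Path A a c ls → length (map toV js) ≤ length ls
    shorter ls p with shortest (map fromV ls) (encode p)
    ... | s≤s js≤ls = subst₂ _≤_ (sym (length-map toV js)) (length-map fromV ls) js≤ls

module Construction (k : ℕ) where

  b : ℕ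
  b = suc (suc (suc k))

  data V : Set where
    X P Q      : Fin b → V
    H1 H2 H3   : V

  A : V → V → Set
  A (X i) (X j) = i ≢ j
  A (X i) (P j) = i ≡ j
  A (P i) (X j) = i ≡ j
  A (X i) (Q j) = i ≡ j
  A (Q i) (X j) = i ≡ j
  A (P _) H1    = ⊤
  A H1    (P _) = ⊤
  A (Q _) H3    = ⊤
  A H3    (Q _) = ⊤
  A H1    H2    = ⊤
  A H2    H1    = ⊤
  A H2    H3    = ⊤
  A H3    H2    = ⊤
  A _     _     = ⊥

  A-irrefl : ∀ {v} → ¬ A v v
  A-irrefl {X i} i≢i = i≢i refl

  A-sym : ∀ {u v} → A u v → A v u
  A-sym {X i} {X j} i≢j = i≢j ∘ sym
  A-sym {X i} {P j} e   = sym e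
  A-sym {P i} {X j} e   = sym e
  A-sym {X i} {Q j} e   = sym e
  A-sym {Q i} {X j} e   = sym e
  A-sym {P _} {H1}  _   = tt
  A-sym {H1}  {P _} _   = tt
  A-sym {Q _} {H3}  _   = tt
  A-sym {H3}  {Q _} _   = tt
  A-sym {H1}  {H2}  _   = tt
  A-sym {H2}  {H1}  _   = tt
  A-sym {H2}  {H3}  _   = tt
  A-sym {H3}  {H2}  _   = tt

  X-distinct : ∀ {i j} → i ≢ j → X i ≢ X j
  X-distinct i≢j refl = i≢j refl

  P-distinct : ∀ {i j} → i ≢ j → P i ≢ P j
  P-distinct i≢j refl = i≢j refl

  Q-distinct : ∀ {i j} → i ≢ j → Q i ≢ Q j
  Q-distinct i≢j refl = i≢j refl

  cS : V → Fin b
  cS (X i) = i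
  cS (P _) = zero
  cS (Q _) = zero
  cS H1    = suc zero
  cS H2    = zero
  cS H3    = suc zero

  -- the 3-colouring for rvc: the hub path H₁ H₂ H₃ is rainbow
  cR : V → Fin 3
  cR (X _) = zero
  cR (P _) = suc zero
  cR (Q _) = suc zero
  cR H1    = zero
  cR H2    = suc zero
  cR H3    = suc (suc zero)

  -- pairs {Pᵢ, Qⱼ}: for i ≠ j their geodesic Pᵢ Xᵢ Xⱼ Qⱼ is not rainbow under cR
  data Special : V → V → Set where
    pq : ∀ {i j} → Special (P i) (Q j)
    qp : ∀ {i j} → Special (Q i) (P j)

  record Route (a c : V) : Set where
    constructor mkRoute
    field
      internal : List V
      walk     : Walk A a c internal
      unique   : Unique (a ∷ internal ++ [ c ])
      shortest : ∀ ls → Walk A a c ls → length internal ≤ length ls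
      rainbowS : Rainbow cS internal
      rainbowR : Special a c ⊎ Rainbow cR internal

  route : ∀ a c → a ≢ c → Route a c
  route (X i) (X j) a≢c with i ≟F j
  ... | yes refl = ⊥-elim (a≢c refl)
  ... | no i≢j = mkRoute [] (i≢j ∷ [-]) (distinct₂ (X-distinct i≢j)) (λ _ _ → z≤n) [] (inj₂ [])
  route (X i) (P j) _ with i ≟F j
  ... | yes refl = mkRoute [] (refl ∷ [-]) (distinct₂ (λ ())) (λ _ _ → z≤n) [] (inj₂ [])
  ... | no i≢j = mkRoute [ X j ] (i≢j ∷ refl ∷ [-]) (distinct₃ (X-distinct i≢j) (λ ()) (λ ())) (nonadjacent⇒internal≥1 i≢j) ([] ∷ []) (inj₂ ([] ∷ []))
  route (X i) (Q j) _ with i ≟F j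
  ... | yes refl = mkRoute [] (refl ∷ [-]) (distinct₂ (λ ())) (λ _ _ → z≤n) [] (inj₂ [])
  ... | no i≢j = mkRoute [ X j ] (i≢j ∷ refl ∷ [-]) (distinct₃ (X-distinct i≢j) (λ ()) (λ ())) (nonadjacent⇒internal≥1 i≢j) ([] ∷ []) (inj₂ ([] ∷ []))
  route (X i) H1 _ = mkRoute [ P i ] (refl ∷ tt ∷ [-]) (distinct₃ (λ ()) (λ ()) (λ ())) (nonadjacent⇒internal≥1 (λ ())) ([] ∷ []) (inj₂ ([] ∷ []))
  route (X i) H2 _ = mkRoute (P i ∷ H1 ∷ []) (refl ∷ tt ∷ tt ∷ [-])
    (distinct₄ (λ ()) (λ ()) (λ ()) (λ ()) (λ ()) (λ ()))
    (distant⇒internal≥2 (λ ()) λ { (X _) _ () ; (P _) _ () ; (Q _) _ () ; H1 () _ ; H2 () _ ; H3 () _ })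
    (allPairs₂ (λ ())) (inj₂ (allPairs₂ (λ ())))
  route (X i) H3 _ = mkRoute [ Q i ] (refl ∷ tt ∷ [-]) (distinct₃ (λ ()) (λ ()) (λ ())) (nonadjacent⇒internal≥1 (λ ())) ([] ∷ []) (inj₂ ([] ∷ []))
  route (P i) (X j) _ with i ≟F j
  ... | yes refl = mkRoute [] (refl ∷ [-]) (distinct₂ (λ ())) (λ _ _ → z≤n) [] (inj₂ [])
  ... | no i≢j = mkRoute [ X i ] (refl ∷ i≢j ∷ [-]) (distinct₃ (λ ()) (λ ()) (X-distinct i≢j)) (nonadjacent⇒internal≥1 i≢j) ([] ∷ []) (inj₂ ([] ∷ []))
  route (P i) (P j) a≢c with i ≟F j
  ... | yes refl = ⊥-elim (a≢c refl)
  ... | no i≢j = mkRoute [ H1 ] (tt ∷ tt ∷ [-]) (distinct₃ (λ ()) (P-distinct i≢j) (λ ())) (nonadjacent⇒internal≥1 (λ ())) ([] ∷ []) (inj₂ ([] ∷ []))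
  route (P i) (Q j) _ with i ≟F j
  ... | yes refl = mkRoute [ X i ] (refl ∷ refl ∷ [-]) (distinct₃ (λ ()) (λ ()) (λ ())) (nonadjacent⇒internal≥1 (λ ())) ([] ∷ []) (inj₂ ([] ∷ []))
  ... | no i≢j = mkRoute (X i ∷ X j ∷ []) (refl ∷ i≢j ∷ refl ∷ [-])
    (distinct₄ (λ ()) (λ ()) (λ ()) (X-distinct i≢j) (λ ()) (λ ()))
    (distant⇒internal≥2 (λ ()) λ { (X l) i≡l l≡j → i≢j (trans i≡l l≡j) ; H1 _ () ; (P _) () _ ; (Q _) () _ ; H2 () _ ; H3 () _ })
    (allPairs₂ i≢j) (inj₁ pq)
  route (P i) H1 _ = mkRoute [] (tt ∷ [-]) (distinct₂ (λ ())) (λ _ _ → z≤n) [] (inj₂ [])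
  route (P i) H2 _ = mkRoute [ H1 ] (tt ∷ tt ∷ [-]) (distinct₃ (λ ()) (λ ()) (λ ())) (nonadjacent⇒internal≥1 (λ ())) ([] ∷ []) (inj₂ ([] ∷ []))
  route (P i) H3 _ = mkRoute (H1 ∷ H2 ∷ []) (tt ∷ tt ∷ tt ∷ [-])
    (distinct₄ (λ ()) (λ ()) (λ ()) (λ ()) (λ ()) (λ ()))
    (distant⇒internal≥2 (λ ()) λ { (X _) _ () ; (P _) () _ ; (Q _) () _ ; H1 _ () ; H2 () _ ; H3 () _ })
    (allPairs₂ (λ ())) (inj₂ (allPairs₂ (λ ())))
  route (Q i) (X j) _ with i ≟F j
  ... | yes refl = mkRoute [] (refl ∷ [-]) (distinct₂ (λ ())) (λ _ _ → z≤n) [] (inj₂ [])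
  ... | no i≢j = mkRoute [ X i ] (refl ∷ i≢j ∷ [-]) (distinct₃ (λ ()) (λ ()) (X-distinct i≢j)) (nonadjacent⇒internal≥1 i≢j) ([] ∷ []) (inj₂ ([] ∷ []))
  route (Q i) (P j) _ with i ≟F j
  ... | yes refl = mkRoute [ X i ] (refl ∷ refl ∷ [-]) (distinct₃ (λ ()) (λ ()) (λ ())) (nonadjacent⇒internal≥1 (λ ())) ([] ∷ []) (inj₂ ([] ∷ []))
  ... | no i≢j = mkRoute (X i ∷ X j ∷ []) (refl ∷ i≢j ∷ refl ∷ [-])
    (distinct₄ (λ ()) (λ ()) (λ ()) (X-distinct i≢j) (λ ()) (λ ()))
    (distant⇒internal≥2 (λ ()) λ { (X l) i≡l l≡j → i≢j (trans i≡l l≡j) ; H3 _ () ; (P _) () _ ; (Q _) () _ ; H2 () _ ; H1 () _ })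
    (allPairs₂ i≢j) (inj₁ qp)
  route (Q i) (Q j) a≢c with i ≟F j
  ... | yes refl = ⊥-elim (a≢c refl)
  ... | no i≢j = mkRoute [ H3 ] (tt ∷ tt ∷ [-]) (distinct₃ (λ ()) (Q-distinct i≢j) (λ ())) (nonadjacent⇒internal≥1 (λ ())) ([] ∷ []) (inj₂ ([] ∷ []))
  route (Q i) H1 _ = mkRoute (H3 ∷ H2 ∷ []) (tt ∷ tt ∷ tt ∷ [-])
    (distinct₄ (λ ()) (λ ()) (λ ()) (λ ()) (λ ()) (λ ()))
    (distant⇒internal≥2 (λ ()) λ { (X _) _ () ; (P _) () _ ; (Q _) () _ ; H3 _ () ; H2 () _ ; H1 () _ })
    (allPairs₂ (λ ())) (inj₂ (allPairs₂ (λ ())))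
  route (Q i) H2 _ = mkRoute [ H3 ] (tt ∷ tt ∷ [-]) (distinct₃ (λ ()) (λ ()) (λ ())) (nonadjacent⇒internal≥1 (λ ())) ([] ∷ []) (inj₂ ([] ∷ []))
  route (Q i) H3 _ = mkRoute [] (tt ∷ [-]) (distinct₂ (λ ())) (λ _ _ → z≤n) [] (inj₂ [])
  route H1 (X j) _ = mkRoute [ P j ] (tt ∷ refl ∷ [-]) (distinct₃ (λ ()) (λ ()) (λ ())) (nonadjacent⇒internal≥1 (λ ())) ([] ∷ []) (inj₂ ([] ∷ []))
  route H1 (P j) _ = mkRoute [] (tt ∷ [-]) (distinct₂ (λ ())) (λ _ _ → z≤n) [] (inj₂ [])
  route H1 (Q j) _ = mkRoute (H2 ∷ H3 ∷ []) (tt ∷ tt ∷ tt ∷ [-])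
    (distinct₄ (λ ()) (λ ()) (λ ()) (λ ()) (λ ()) (λ ()))
    (distant⇒internal≥2 (λ ()) λ { (X _) () _ ; (P _) _ () ; (Q _) () _ ; H2 _ () ; H1 () _ ; H3 () _ })
    (allPairs₂ (λ ())) (inj₂ (allPairs₂ (λ ())))
  route H1 H1 a≢c = ⊥-elim (a≢c refl)
  route H1 H2 _ = mkRoute [] (tt ∷ [-]) (distinct₂ (λ ())) (λ _ _ → z≤n) [] (inj₂ [])
  route H1 H3 _ = mkRoute [ H2 ] (tt ∷ tt ∷ [-]) (distinct₃ (λ ()) (λ ()) (λ ())) (nonadjacent⇒internal≥1 (λ ())) ([] ∷ []) (inj₂ ([] ∷ []))
  route H2 (X j) _ = mkRoute (H1 ∷ P j ∷ []) (tt ∷ tt ∷ refl ∷ [-])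
    (distinct₄ (λ ()) (λ ()) (λ ()) (λ ()) (λ ()) (λ ()))
    (distant⇒internal≥2 (λ ()) λ { (X _) () _ ; (P _) () _ ; (Q _) () _ ; H1 _ () ; H2 () _ ; H3 _ () })
    (allPairs₂ (λ ())) (inj₂ (allPairs₂ (λ ())))
  route H2 (P j) _ = mkRoute [ H1 ] (tt ∷ tt ∷ [-]) (distinct₃ (λ ()) (λ ()) (λ ())) (nonadjacent⇒internal≥1 (λ ())) ([] ∷ []) (inj₂ ([] ∷ []))
  route H2 (Q j) _ = mkRoute [ H3 ] (tt ∷ tt ∷ [-]) (distinct₃ (λ ()) (λ ()) (λ ())) (nonadjacent⇒internal≥1 (λ ())) ([] ∷ []) (inj₂ ([] ∷ []))
  route H2 H1 _ = mkRoute [] (tt ∷ [-]) (distinct₂ (λ ())) (λ _ _ → z≤n) [] (inj₂ [])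
  route H2 H2 a≢c = ⊥-elim (a≢c refl)
  route H2 H3 _ = mkRoute [] (tt ∷ [-]) (distinct₂ (λ ())) (λ _ _ → z≤n) [] (inj₂ [])
  route H3 (X j) _ = mkRoute [ Q j ] (tt ∷ refl ∷ [-]) (distinct₃ (λ ()) (λ ()) (λ ())) (nonadjacent⇒internal≥1 (λ ())) ([] ∷ []) (inj₂ ([] ∷ []))
  route H3 (P j) _ = mkRoute (H2 ∷ H1 ∷ []) (tt ∷ tt ∷ tt ∷ [-])
    (distinct₄ (λ ()) (λ ()) (λ ()) (λ ()) (λ ()) (λ ()))
    (distant⇒internal≥2 (λ ()) λ { (X _) () _ ; (P _) () _ ; (Q _) _ () ; H2 _ () ; H1 () _ ; H3 () _ })
    (allPairs₂ (λ ())) (inj₂ (allPairs₂ (λ ())))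
  route H3 (Q j) _ = mkRoute [] (tt ∷ [-]) (distinct₂ (λ ())) (λ _ _ → z≤n) [] (inj₂ [])
  route H3 H1 _ = mkRoute [ H2 ] (tt ∷ tt ∷ [-]) (distinct₃ (λ ()) (λ ()) (λ ())) (nonadjacent⇒internal≥1 (λ ())) ([] ∷ []) (inj₂ ([] ∷ []))
  route H3 H2 _ = mkRoute [] (tt ∷ [-]) (distinct₂ (λ ())) (λ _ _ → z≤n) [] (inj₂ [])
  route H3 H3 a≢c = ⊥-elim (a≢c refl)

  rainbowGeodesics : RainbowGeodesics A cS
  rainbowGeodesics a c a≢c with route a c a≢c
  ... | mkRoute ks walk unique shortest rainbowS _ =
    ks , ((walk , unique) , λ ls path → shortest ls (proj₁ path)) , rainbowS

  hubDetour : ∀ {a c} → Special a c → ∃ λ ks → Path A a c ks × Rainbow cR ks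
  hubDetour pq = H1 ∷ H2 ∷ H3 ∷ [] , (tt ∷ tt ∷ tt ∷ tt ∷ [-] , fiveDistinct) , threeColours
    where
    fiveDistinct = ((λ ()) ∷ (λ ()) ∷ (λ ()) ∷ (λ ()) ∷ []) ∷ ((λ ()) ∷ (λ ()) ∷ (λ ()) ∷ [])
                   ∷ ((λ ()) ∷ (λ ()) ∷ []) ∷ ((λ ()) ∷ []) ∷ [] ∷ []
    threeColours = ((λ ()) ∷ (λ ()) ∷ []) ∷ ((λ ()) ∷ []) ∷ [] ∷ []
  hubDetour qp = H3 ∷ H2 ∷ H1 ∷ [] , (tt ∷ tt ∷ tt ∷ tt ∷ [-] , fiveDistinct) , threeColours
    where
    fiveDistinct = ((λ ()) ∷ (λ ()) ∷ (λ ()) ∷ (λ ()) ∷ []) ∷ ((λ ()) ∷ (λ ()) ∷ (λ ()) ∷ [])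
                   ∷ ((λ ()) ∷ (λ ()) ∷ []) ∷ ((λ ()) ∷ []) ∷ [] ∷ []
    threeColours = ((λ ()) ∷ (λ ()) ∷ []) ∷ ((λ ()) ∷ []) ∷ [] ∷ []

  rainbowPaths : RainbowPaths A cR
  rainbowPaths a c a≢c with route a c a≢c
  ... | mkRoute ks walk unique _ _ (inj₂ rainbowR) = ks , (walk , unique) , rainbowR
  ... | mkRoute _ _ _ _ _ (inj₁ special)          = hubDetour special

  P-neighbour : ∀ {i w} → A (P i) w → w ≡ X i ⊎ w ≡ H1
  P-neighbour {w = X _} refl = inj₁ refl
  P-neighbour {w = H1}  _    = inj₂ refl

  Q-neighbour : ∀ {j w} → A w (Q j) → w ≡ X j ⊎ w ≡ H3
  Q-neighbour {w = X _} refl = inj₁ refl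
  Q-neighbour {w = H3}  _    = inj₂ refl

  short-PQ-walk : ∀ {i j} → i ≢ j → ∀ ks → Walk A (P i) (Q j) ks → length ks ≤ 2 → ks ≡ X i ∷ X j ∷ []
  short-PQ-walk _ [] (() ∷ _) _
  short-PQ-walk i≢j (w ∷ []) (p~w ∷ w~q ∷ _) _ with P-neighbour p~w | Q-neighbour w~q
  ... | inj₁ refl | inj₁ refl = ⊥-elim (i≢j refl)
  ... | inj₁ refl | inj₂ ()
  ... | inj₂ refl | inj₁ ()
  ... | inj₂ refl | inj₂ ()
  short-PQ-walk _ (w ∷ w′ ∷ []) (p~w ∷ w~w′ ∷ w′~q ∷ _) _ with P-neighbour p~w | Q-neighbour w′~q
  ... | inj₁ refl | inj₁ refl = refl
  ... | inj₁ refl | inj₂ refl = ⊥-elim w~w′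
  ... | inj₂ refl | inj₁ refl = ⊥-elim w~w′
  ... | inj₂ refl | inj₂ refl = ⊥-elim w~w′
  short-PQ-walk _ (_ ∷ _ ∷ _ ∷ _) _ (s≤s (s≤s ()))

  short-rainbow-PQ : ∀ {m} (col : V → Fin m) {i j} → i ≢ j → ∀ {ks} → Walk A (P i) (Q j) ks →
                     length ks ≤ 2 → Rainbow col ks → col (X i) ≢ col (X j)
  short-rainbow-PQ col i≢j {ks} walk short rainbow
    rewrite short-PQ-walk i≢j ks walk short with rainbow
  ... | (differ ∷ []) ∷ _ = differ

  clique-clash : ∀ {m} → m < b → (col : V → Fin m) → ∃₂ λ i j → i ≢ j × col (X i) ≡ col (X j)
  clique-clash m<b col with pigeonhole m<b (col ∘ X)
  ... | i , j , i<j , same = i , j , <⇒≢ i<j , same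

  clique-PQ-path : ∀ {i j} → i ≢ j → Path A (P i) (Q j) (X i ∷ X j ∷ [])
  clique-PQ-path i≢j = refl ∷ i≢j ∷ refl ∷ [-] , distinct₄ (λ ()) (λ ()) (λ ()) (X-distinct i≢j) (λ ()) (λ ())

  -- srvc ≥ b: with fewer colours, the geodesic between Pᵢ and Qⱼ has length 3
  -- and so runs through Xᵢ Xⱼ, which share a colour.
  fewer-than-b-not-strong : ∀ {m} → m < b → (col : V → Fin m) → ¬ RainbowGeodesics A col
  fewer-than-b-not-strong m<b col srv with clique-clash m<b col
  ... | i , j , i≢j , same with srv (P i) (Q j) (λ ())
  ...   | ks , ((walk , _) , shortest) , rainbow =
          short-rainbow-PQ col i≢j walk (shortest (X i ∷ X j ∷ []) (clique-PQ-path i≢j)) rainbow same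

  -- rvc ≥ 3: with at most two colours a rainbow path has at most two internal
  -- vertices, and the same clash occurs.
  fewer-than-3-not-rainbow : ∀ {m} → m < 3 → (col : V → Fin m) → ¬ RainbowPaths A col
  fewer-than-3-not-rainbow m<3 col rv with clique-clash (≤-trans m<3 (s≤s (s≤s (s≤s z≤n)))) col
  ... | i , j , i≢j , same with rv (P i) (Q j) (λ ())
  ...   | ks , (walk , _) , rainbow =
          short-rainbow-PQ col i≢j walk (≤-pred (≤-trans (s≤s (rainbow-length col rainbow)) m<3)) rainbow same

  N : ℕ
  N = suc (suc (suc (b + (b + b))))

  afterHubs : Fin (b + (b + b)) → Fin N
  afterHubs x = suc (suc (suc x))

  toV : Fin N → V
  toV zero                = H1
  toV (suc zero)          = H2
  toV (suc (suc zero))    = H3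
  toV (suc (suc (suc x))) = either X (either P Q ∘ splitAt b) (splitAt b x)

  fromV : V → Fin N
  fromV H1    = zero
  fromV H2    = suc zero
  fromV H3    = suc (suc zero)
  fromV (X i) = afterHubs (i ↑ˡ (b + b))
  fromV (P i) = afterHubs (b ↑ʳ (i ↑ˡ b))
  fromV (Q i) = afterHubs (b ↑ʳ (b ↑ʳ i))

  toV-fromV : ∀ v → toV (fromV v) ≡ v
  toV-fromV H1 = refl
  toV-fromV H2 = refl
  toV-fromV H3 = refl
  toV-fromV (X i) rewrite splitAt-↑ˡ b i (b + b) = refl
  toV-fromV (P i) rewrite splitAt-↑ʳ b (b + b) (i ↑ˡ b) | splitAt-↑ˡ b i b = refl
  toV-fromV (Q i) rewrite splitAt-↑ʳ b (b + b) (b ↑ʳ i) | splitAt-↑ʳ b b i = refl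

  fromV-toV : ∀ x → fromV (toV x) ≡ x
  fromV-toV zero                = refl
  fromV-toV (suc zero)          = refl
  fromV-toV (suc (suc zero))    = refl
  fromV-toV (suc (suc (suc x))) with splitAt b x in split₁
  ... | inj₁ i = cong afterHubs (splitAt⁻¹-↑ˡ split₁)
  ... | inj₂ y with splitAt b y in split₂
  ...   | inj₁ i = cong afterHubs (trans (cong (b ↑ʳ_) (splitAt⁻¹-↑ˡ split₂)) (splitAt⁻¹-↑ʳ split₁))
  ...   | inj₂ i = cong afterHubs (trans (cong (b ↑ʳ_) (splitAt⁻¹-↑ʳ split₂)) (splitAt⁻¹-↑ʳ split₁))

  open Encoding A A-irrefl A-sym N toV fromV toV-fromV fromV-toV public

lemma4p8 : (b : ℕ) → 3 ≤ b → Σ Graph (λ G → Connected G × rvc≡ G 3 × srvc≡ G b)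
lemma4p8 (suc (suc (suc k))) (s≤s (s≤s (s≤s _))) =
    graph
  , rvConnecting⇒connected graph (cR ∘ toV) rvc-upper
  , ((cR ∘ toV , rvc-upper) , rvc-lower)
  , ((cS ∘ toV , srvc-upper) , srvc-lower)
  where
  open Construction k

  rvc-upper : RVConnecting graph (cR ∘ toV)
  rvc-upper = rvConnecting↑ cR rainbowPaths

  srvc-upper : SRVConnecting graph (cS ∘ toV)
  srvc-upper = srvConnecting↑ cS rainbowGeodesics

  rvc-lower : ∀ m → m < 3 → (c : Fin N → Fin m) → ¬ RVConnecting graph c
  rvc-lower m m<3 c = fewer-than-3-not-rainbow m<3 (c ∘ fromV) ∘ rvConnecting↓ c

  srvc-lower : ∀ m → m < b → (c : Fin N → Fin m) → ¬ SRVConnecting graph c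
  srvc-lower m m<b c = fewer-than-b-not-strong m<b (c ∘ fromV) ∘ srvConnecting↓ c
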